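{- Let $n\in\{6,7\}$ and $m$ a positive integer, let $G_0$ be the graph obtained from $K_n$ by removing a matching of size $m$, and let $\mathcal{D}_0$ be a partition of $E(G_0)$ into parts each of which is a triangle or a single edge. If each vertex of $G_0$ belongs to exactly $3$ parts of $\mathcal{D}_0$, then $m=3$.
   Context: A vertex belongs to a part if it is a vertex of that triangle or edge. -}

module Defs where

open import Data.Nat using (ℕ; _≤_; suc; _≡ᵇ_)
open import Data.Fin using (Fin)
open import Data.Fin.Properties using (_≟_)
open import Data.Bool using (Bool; true; false; _∧_; _∨_; not)
open import Data.List using (List; []; _∷_; length)
open import Data.List.Relation.Unary.All using (All)
open import Data.Product using (_×_; _,_)
open import Relation.Nullary.Decidable using (⌊_⌋)
open import Relation.Binary.PropositionalEquality using (_≡_)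
open import Relation.Nullary using (¬_)

_==_ : ∀ {n} → Fin n → Fin n → Bool
a == b = ⌊ a ≟ b ⌋

count : ∀ {A : Set} → (A → Bool) → List A → ℕ
count p [] = 0
count p (x ∷ xs) with p x
... | true  = suc (count p xs)
... | false = count p xs

samePair : ∀ {n} → Fin n → Fin n → Fin n → Fin n → Bool
samePair u v a b = ((u == a) ∧ (v == b)) ∨ ((u == b) ∧ (v == a))

Pair : ℕ → Set
Pair n = Fin n × Fin n

onPair : ∀ {n} → Fin n → Pair n → Bool
onPair v (a , b) = (v == a) ∨ (v == b)

IsMatching : ∀ {n} → List (Pair n) → Set
IsMatching {n} M =
  All (λ { (a , b) → ¬ (a ≡ b) }) M ×
  ((v : Fin n) → count (onPair v) M ≤ 1)

inMatching : ∀ {n} → List (Pair n) → Fin n → Fin n → Bool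
inMatching M u v = not (count (λ { (a , b) → samePair u v a b }) M ≡ᵇ 0)

IsEdgeG₀ : ∀ {n} → List (Pair n) → Fin n → Fin n → Set
IsEdgeG₀ M u v = ¬ (u ≡ v) × inMatching M u v ≡ false

data Part (n : ℕ) : Set where
  triangle : Fin n → Fin n → Fin n → Part n
  edge     : Fin n → Fin n → Part n

edgeOfPart : ∀ {n} → Fin n → Fin n → Part n → Bool
edgeOfPart u v (triangle a b c) = samePair u v a b ∨ samePair u v b c ∨ samePair u v a c
edgeOfPart u v (edge a b)       = samePair u v a b

vertexOfPart : ∀ {n} → Fin n → Part n → Bool
vertexOfPart v (triangle a b c) = (v == a) ∨ (v == b) ∨ (v == c)
vertexOfPart v (edge a b)       = (v == a) ∨ (v == b)

PartInG₀ : ∀ {n} → List (Pair n) → Part n → Set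
PartInG₀ M (triangle a b c) = IsEdgeG₀ M a b × IsEdgeG₀ M b c × IsEdgeG₀ M a c
PartInG₀ M (edge a b)       = IsEdgeG₀ M a b

IsDecomposition : ∀ {n} → List (Pair n) → List (Part n) → Set
IsDecomposition {n} M D =
  All (PartInG₀ M) D ×
  ((u v : Fin n) → IsEdgeG₀ M u v → count (edgeOfPart u v) D ≡ 1)

partsAt : ∀ {n} → List (Part n) → Fin n → ℕ
partsAt D v = count (vertexOfPart v) D

-- Every part has a number of vertices plus edges divisible by 3 (3 + 3 for a triangle,
-- 2 + 1 for an edge). Summing over the parts counts each edge of G₀ once and, by hypothesis,
-- each vertex three times, so 3 divides |E(G₀)| = n(n-1)/2 - m. For n = 6, 7 the number
-- n(n-1)/2 is itself divisible by 3, hence so is m; and a matching of K_n with n ≤ 7 has at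
-- most 3 edges. Counting edges as ordered pairs of vertices, i.e. twice, turns the invariant
-- into 3 ∣ 2 · #vertices + #ordered edges.
module Submission where

open import Defs
open import Data.Nat using (ℕ; zero; suc; _+_; _*_; _≤_; _≥_; _≡ᵇ_; z≤n; s≤s)
open import Data.Nat.Properties
  using (+-*-semiring; +-mono-≤; +-cancelʳ-≡; *-identityʳ; ≤-refl; ≤-trans; n≤1+n; m≤n⇒m≤1+n;
         module ≤-Reasoning)
open import Data.Nat.Divisibility
  using (_∣_; divides; _∣0; ∣m∣n⇒∣m+n; ∣m+n∣m⇒∣n; ∣n⇒∣m*n; n∣m*n; n∣m⇒m%n≡0)
open import Data.Fin using (Fin; zero; suc)
open import Data.Fin.Properties using (_≟_)
open import Data.Bool using (Bool; true; false; _∧_; _∨_; not)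
open import Data.Bool.Properties using (∧-comm; ∨-comm; ∧-conicalˡ; ∧-conicalʳ; ∨-zeroʳ; ¬-not)
open import Data.List using (List; []; _∷_; length; lookup)
open import Data.List.Relation.Unary.All as All using (All; []; _∷_)
open import Data.List.Membership.Propositional.Properties using (∈-lookup)
open import Data.Product using (_×_; _,_; proj₁; proj₂)
open import Data.Sum using (_⊎_; inj₁; inj₂)
open import Data.Empty using (⊥-elim)
open import Function using (_∘_)
open import Relation.Binary.PropositionalEquality
  using (_≡_; _≢_; _≗_; refl; sym; trans; cong; cong₂; subst; module ≡-Reasoning)
open import Relation.Nullary using (¬_; yes; no; contradiction)

open import Algebra.Properties.Semiring.Sum +-*-semiring
  using (sum; sum-syntax; sum-cong-≗; sum-replicate-zero; ∑-distrib-+; ∑-comm; *-distribˡ-sum)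

private
  variable
    A : Set
    n : ℕ
    a b c d v u : Fin n
    M : List (Pair n)
    D : List (Part n)

[_] : Bool → ℕ
[ true ]  = 1
[ false ] = 0

[∨] : ∀ x y → (x ≡ true → y ≡ false) → [ x ∨ y ] ≡ [ x ] + [ y ]
[∨] true  y excl rewrite excl refl = refl
[∨] false y _                      = refl

[not]+[] : ∀ x → [ not x ] + [ x ] ≡ 1
[not]+[] true  = refl
[not]+[] false = refl

m≤1⇒m≡[m≢0] : ∀ {m} → m ≤ 1 → m ≡ [ not (m ≡ᵇ 0) ]
m≤1⇒m≡[m≢0] z≤n       = refl
m≤1⇒m≡[m≢0] (s≤s z≤n) = refl

∨-true : ∀ x {y} → x ∨ y ≡ true → x ≡ true ⊎ y ≡ true
∨-true true  _ = inj₁ refl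
∨-true false y = inj₂ y

∑-const : ∀ n c → ∑[ i < n ] c ≡ n * c
∑-const zero    c = refl
∑-const (suc n) c = cong (c +_) (∑-const n c)

∑-mono-≤ : ∀ {f g : Fin n → ℕ} → (∀ i → f i ≤ g i) → sum f ≤ sum g
∑-mono-≤ {zero}  f≤g = z≤n
∑-mono-≤ {suc n} f≤g = +-mono-≤ (f≤g zero) (∑-mono-≤ (f≤g ∘ suc))

∣-∑ : ∀ {d} {f : Fin n → ℕ} → (∀ i → d ∣ f i) → d ∣ sum f
∣-∑ {zero}  {d} _   = d ∣0
∣-∑ {suc n}     d∣f = ∣m∣n⇒∣m+n (d∣f zero) (∣-∑ (d∣f ∘ suc))

∑∑-distrib-+ : ∀ (f g : Fin n → Fin n → ℕ) →
               ∑[ v < n ] ∑[ u < n ] (f v u + g v u)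
                 ≡ ∑[ v < n ] ∑[ u < n ] f v u + ∑[ v < n ] ∑[ u < n ] g v u
∑∑-distrib-+ {n} f g =
  trans (sum-cong-≗ (λ v → ∑-distrib-+ (f v) (g v)))
        (∑-distrib-+ (λ v → ∑[ u < n ] f v u) (λ v → ∑[ u < n ] g v u))

∑-[∨] : ∀ (f g : Fin n → Bool) → (∀ i → f i ≡ true → g i ≡ false) →
        ∑[ i < n ] [ f i ∨ g i ] ≡ ∑[ i < n ] [ f i ] + ∑[ i < n ] [ g i ]
∑-[∨] f g excl =
  trans (sum-cong-≗ (λ i → [∨] (f i) (g i) (excl i)))
        (∑-distrib-+ (λ i → [ f i ]) (λ i → [ g i ]))

∑∑-[∨] : ∀ (f g : Fin n → Fin n → Bool) → (∀ v u → f v u ≡ true → g v u ≡ false) →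
         ∑[ v < n ] ∑[ u < n ] [ f v u ∨ g v u ]
           ≡ ∑[ v < n ] ∑[ u < n ] [ f v u ] + ∑[ v < n ] ∑[ u < n ] [ g v u ]
∑∑-[∨] f g excl =
  trans (sum-cong-≗ (λ v → sum-cong-≗ (λ u → [∨] (f v u) (g v u) (excl v u))))
        (∑∑-distrib-+ (λ v u → [ f v u ]) (λ v u → [ g v u ]))

∑-[not]+∑-[] : ∀ (f : Fin n → Bool) → ∑[ i < n ] [ not (f i) ] + ∑[ i < n ] [ f i ] ≡ n
∑-[not]+∑-[] {n} f = begin
  ∑[ i < n ] [ not (f i) ] + ∑[ i < n ] [ f i ]  ≡⟨ ∑-distrib-+ (λ i → [ not (f i) ]) (λ i → [ f i ]) ⟨
  ∑[ i < n ] ([ not (f i) ] + [ f i ])           ≡⟨ sum-cong-≗ ([not]+[] ∘ f) ⟩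
  ∑[ i < n ] 1                                   ≡⟨ ∑-const n 1 ⟩
  n * 1                                          ≡⟨ *-identityʳ n ⟩
  n                                              ∎
  where open ≡-Reasoning

==-refl : ∀ (a : Fin n) → a == a ≡ true
==-refl a with a ≟ a
... | yes _   = refl
... | no a≢a = ⊥-elim (a≢a refl)

==⇒≡ : a == b ≡ true → a ≡ b
==⇒≡ {a = a} {b} eq with a ≟ b
==⇒≡ _  | yes a≡b = a≡b
==⇒≡ () | no _

≢⇒==false : a ≢ b → a == b ≡ false
≢⇒==false {a = a} {b} a≢b with a ≟ b
... | yes a≡b = ⊥-elim (a≢b a≡b)
... | no _    = refl

==-excl : a ≢ b → v == a ≡ true → v == b ≡ false
==-excl a≢b v≡a = ≢⇒==false (λ v≡b → a≢b (trans (sym (==⇒≡ v≡a)) v≡b))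

-- Not provable by refl: both sides are stuck on v ≟ a, and map′ changes the proof component.
suc-==-suc : (suc v == suc a) ≡ (v == a)
suc-==-suc {v = v} {a} with v ≟ a
... | yes _ = refl
... | no _  = refl

∑-[==] : ∀ (a : Fin n) → ∑[ v < n ] [ v == a ] ≡ 1
∑-[==] {suc n} zero    = cong suc (sum-replicate-zero n)
∑-[==] {suc n} (suc a) =
  trans (sum-cong-≗ (λ v → cong [_] (suc-==-suc {v = v} {a = a}))) (∑-[==] a)

∑-[∧==] : ∀ x (b : Fin n) → ∑[ u < n ] [ x ∧ (u == b) ] ≡ [ x ]
∑-[∧==]     true  b = ∑-[==] b
∑-[∧==] {n} false b = sum-replicate-zero n

∑∑-point : ∀ (a b : Fin n) → ∑[ v < n ] ∑[ u < n ] [ (v == a) ∧ (u == b) ] ≡ 1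
∑∑-point a b = trans (sum-cong-≗ (λ v → ∑-[∧==] (v == a) b)) (∑-[==] a)

∑∑-[≢] : ∑[ v < n ] ∑[ u < n ] [ not (v == u) ] + n ≡ n * n
∑∑-[≢] {n} = begin
  ∑[ v < n ] ∑[ u < n ] [ not (v == u) ] + n
    ≡⟨ cong (∑[ v < n ] ∑[ u < n ] [ not (v == u) ] +_) diagonal ⟨
  ∑[ v < n ] ∑[ u < n ] [ not (v == u) ] + ∑[ v < n ] ∑[ u < n ] [ v == u ]
    ≡⟨ ∑-distrib-+ (λ v → ∑[ u < n ] [ not (v == u) ]) (λ v → ∑[ u < n ] [ v == u ]) ⟨
  ∑[ v < n ] (∑[ u < n ] [ not (v == u) ] + ∑[ u < n ] [ v == u ])
    ≡⟨ sum-cong-≗ {n} (λ v → ∑-[not]+∑-[] (v ==_)) ⟩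
  ∑[ v < n ] n
    ≡⟨ ∑-const n n ⟩
  n * n ∎
  where
  open ≡-Reasoning
  diagonal : ∑[ v < n ] ∑[ u < n ] [ v == u ] ≡ n
  diagonal = trans (∑-comm {n} {n} (λ v u → [ v == u ]))
                   (trans (sum-cong-≗ {n} ∑-[==]) (trans (∑-const n 1) (*-identityʳ n)))

samePair⇒ : samePair v u a b ≡ true → (v ≡ a × u ≡ b) ⊎ (v ≡ b × u ≡ a)
samePair⇒ {v = v} {u} {a} {b} eq with ∨-true ((v == a) ∧ (u == b)) eq
... | inj₁ e = inj₁ (==⇒≡ (∧-conicalˡ _ _ e) , ==⇒≡ (∧-conicalʳ _ _ e))
... | inj₂ e = inj₂ (==⇒≡ (∧-conicalˡ _ _ e) , ==⇒≡ (∧-conicalʳ _ _ e))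

samePair-unique : samePair v u a b ≡ true → samePair v u c d ≡ true →
                  (a ≡ c × b ≡ d) ⊎ (a ≡ d × b ≡ c)
samePair-unique {v = v} {u = u} {a = a} {b = b} {c = c} {d = d} ab cd
  with samePair⇒ {v = v} {u} {a} {b} ab | samePair⇒ {v = v} {u} {c} {d} cd
... | inj₁ (refl , refl) | inj₁ (refl , refl) = inj₁ (refl , refl)
... | inj₁ (refl , refl) | inj₂ (refl , refl) = inj₂ (refl , refl)
... | inj₂ (refl , refl) | inj₁ (refl , refl) = inj₂ (refl , refl)
... | inj₂ (refl , refl) | inj₂ (refl , refl) = inj₁ (refl , refl)

samePair-excl : ¬ ((a ≡ c × b ≡ d) ⊎ (a ≡ d × b ≡ c)) →
                ∀ v u → samePair v u a b ≡ true → samePair v u c d ≡ false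
samePair-excl {a = a} {c = c} {b = b} {d = d} different v u ab =
  ¬-not (λ cd → different (samePair-unique {v = v} {u = u} {a = a} {b = b} {c = c} {d = d} ab cd))

samePair-comm : ∀ (v u a b : Fin n) → samePair u v a b ≡ samePair v u a b
samePair-comm v u a b =
  trans (cong₂ _∨_ (∧-comm (u == a) (v == b)) (∧-comm (u == b) (v == a)))
        (∨-comm ((v == b) ∧ (u == a)) ((v == a) ∧ (u == b)))

samePair⇒onPair : samePair v u a b ≡ true → onPair v (a , b) ≡ true
samePair⇒onPair {v = v} {u} {a} {b} e with samePair⇒ {v = v} {u} {a} {b} e
... | inj₁ (refl , _) = cong (_∨ (v == b)) (==-refl v)
... | inj₂ (refl , _) = trans (cong ((v == a) ∨_) (==-refl v)) (∨-zeroʳ (v == a))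

samePair-loop : samePair v v a b ≡ true → a ≡ b
samePair-loop {v = v} {a} {b} e with samePair⇒ {v = v} {v} {a} {b} e
... | inj₁ (v≡a , v≡b) = trans (sym v≡a) v≡b
... | inj₂ (v≡b , v≡a) = trans (sym v≡a) v≡b

DistinctVertices : Part n → Set
DistinctVertices (triangle a b c) = a ≢ b × b ≢ c × a ≢ c
DistinctVertices (edge a b)       = a ≢ b

vertexCount : Part n → ℕ
vertexCount {n} p = ∑[ v < n ] [ vertexOfPart v p ]

orderedEdgeCount : Part n → ℕ
orderedEdgeCount {n} p = ∑[ v < n ] ∑[ u < n ] [ edgeOfPart v u p ]

vertexCount-edge : a ≢ b → vertexCount (edge a b) ≡ 2
vertexCount-edge {a = a} {b} a≢b =
  trans (∑-[∨] (_== a) (_== b) (λ _ → ==-excl a≢b)) (cong₂ _+_ (∑-[==] a) (∑-[==] b))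

vertexCount-triangle : a ≢ b → b ≢ c → a ≢ c → vertexCount (triangle a b c) ≡ 3
vertexCount-triangle {a = a} {b} {c} a≢b b≢c a≢c =
  trans (∑-[∨] (_== a) (λ v → (v == b) ∨ (v == c))
               (λ _ v≡a → cong₂ _∨_ (==-excl a≢b v≡a) (==-excl a≢c v≡a)))
        (cong₂ _+_ (∑-[==] a) (vertexCount-edge b≢c))

orderedEdgeCount-edge : a ≢ b → orderedEdgeCount (edge a b) ≡ 2
orderedEdgeCount-edge {a = a} {b} a≢b =
  trans (∑∑-[∨] (λ v u → (v == a) ∧ (u == b)) (λ v u → (v == b) ∧ (u == a)) excl)
        (cong₂ _+_ (∑∑-point a b) (∑∑-point b a))
  where
  excl : ∀ v u → (v == a) ∧ (u == b) ≡ true → (v == b) ∧ (u == a) ≡ false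
  excl v u e = cong (_∧ (u == a)) (==-excl a≢b (∧-conicalˡ _ _ e))

orderedEdgeCount-triangle : a ≢ b → b ≢ c → a ≢ c → orderedEdgeCount (triangle a b c) ≡ 6
orderedEdgeCount-triangle {a = a} {b} {c} a≢b b≢c a≢c = begin
  orderedEdgeCount (triangle a b c)
    ≡⟨ ∑∑-[∨] (λ v u → samePair v u a b) (λ v u → samePair v u b c ∨ samePair v u a c)
              (λ v u ab → cong₂ _∨_ (samePair-excl ab≢bc v u ab) (samePair-excl ab≢ac v u ab)) ⟩
  orderedEdgeCount (edge a b) + ∑[ v < _ ] ∑[ u < _ ] [ samePair v u b c ∨ samePair v u a c ]
    ≡⟨ cong (orderedEdgeCount (edge a b) +_)
            (∑∑-[∨] (λ v u → samePair v u b c) (λ v u → samePair v u a c) (samePair-excl bc≢ac)) ⟩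
  orderedEdgeCount (edge a b) + (orderedEdgeCount (edge b c) + orderedEdgeCount (edge a c))
    ≡⟨ cong₂ _+_ (orderedEdgeCount-edge a≢b)
                 (cong₂ _+_ (orderedEdgeCount-edge b≢c) (orderedEdgeCount-edge a≢c)) ⟩
  6 ∎
  where
  open ≡-Reasoning
  ab≢bc : ¬ ((a ≡ b × b ≡ c) ⊎ (a ≡ c × b ≡ b))
  ab≢bc (inj₁ (a≡b , _)) = a≢b a≡b
  ab≢bc (inj₂ (a≡c , _)) = a≢c a≡c
  ab≢ac : ¬ ((a ≡ a × b ≡ c) ⊎ (a ≡ c × b ≡ a))
  ab≢ac (inj₁ (_ , b≡c)) = b≢c b≡c
  ab≢ac (inj₂ (a≡c , _)) = a≢c a≡c
  bc≢ac : ¬ ((b ≡ a × c ≡ c) ⊎ (b ≡ c × c ≡ a))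
  bc≢ac (inj₁ (b≡a , _)) = a≢b (sym b≡a)
  bc≢ac (inj₂ (b≡c , _)) = b≢c b≡c

3∣2*vertexCount+orderedEdgeCount : ∀ (p : Part n) → DistinctVertices p →
                                   3 ∣ 2 * vertexCount p + orderedEdgeCount p
3∣2*vertexCount+orderedEdgeCount (triangle a b c) (a≢b , b≢c , a≢c)
  rewrite vertexCount-triangle a≢b b≢c a≢c | orderedEdgeCount-triangle a≢b b≢c a≢c = divides 4 refl
3∣2*vertexCount+orderedEdgeCount (edge a b) a≢b
  rewrite vertexCount-edge a≢b | orderedEdgeCount-edge a≢b = divides 2 refl

count-∑ : ∀ (p : A → Bool) xs → count p xs ≡ ∑[ i < length xs ] [ p (lookup xs i) ]
count-∑ p []       = refl
count-∑ p (x ∷ xs) with p x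
... | true  = cong suc (count-∑ p xs)
... | false = count-∑ p xs

count-cong : ∀ {p q : A → Bool} → p ≗ q → ∀ xs → count p xs ≡ count q xs
count-cong p≗q [] = refl
count-cong {q = q} p≗q (x ∷ xs) rewrite p≗q x with q x
... | true  = cong suc (count-cong p≗q xs)
... | false = count-cong p≗q xs

count-mono-≤ : ∀ {p q : A → Bool} → (∀ x → p x ≡ true → q x ≡ true) →
               ∀ xs → count p xs ≤ count q xs
count-mono-≤ p⇒q [] = z≤n
count-mono-≤ {p = p} {q} p⇒q (x ∷ xs) with p x in px | q x in qx
... | true  | true  = s≤s (count-mono-≤ p⇒q xs)
... | false | true  = m≤n⇒m≤1+n (count-mono-≤ p⇒q xs)
... | false | false = count-mono-≤ p⇒q xs
... | true  | false with () ← trans (sym (p⇒q x px)) qx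

count-none : ∀ {p : A → Bool} {xs} → All (λ x → p x ≡ false) xs → count p xs ≡ 0
count-none []                   = refl
count-none (px≡false ∷ pxs) rewrite px≡false = count-none pxs

∑-count : ∀ (R : Fin n → A → Bool) xs →
          ∑[ v < n ] count (R v) xs ≡ ∑[ i < length xs ] ∑[ v < n ] [ R v (lookup xs i) ]
∑-count R xs =
  trans (sum-cong-≗ (λ v → count-∑ (R v) xs)) (∑-comm (λ v i → [ R v (lookup xs i) ]))

∑∑-count : ∀ (R : Fin n → Fin n → A → Bool) xs →
           ∑[ v < n ] ∑[ u < n ] count (R v u) xs
             ≡ ∑[ i < length xs ] ∑[ v < n ] ∑[ u < n ] [ R v u (lookup xs i) ]
∑∑-count {n} R xs =
  trans (sum-cong-≗ (λ v → ∑-count (R v) xs))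
        (∑-comm (λ v i → ∑[ u < n ] [ R v u (lookup xs i) ]))

inMatching-comm : ∀ (M : List (Pair n)) v u → inMatching M u v ≡ inMatching M v u
inMatching-comm M v u =
  cong (λ k → not (k ≡ᵇ 0))
       (count-cong {p = λ { (a , b) → samePair u v a b }} (λ { (a , b) → samePair-comm v u a b }) M)

module _ {M : List (Pair n)} where

  IsEdgeG₀-sym : IsEdgeG₀ M v u → IsEdgeG₀ M u v
  IsEdgeG₀-sym {v} {u} (v≢u , unmatched) = v≢u ∘ sym , trans (inMatching-comm M v u) unmatched

  samePair⇒IsEdgeG₀ : samePair v u a b ≡ true → IsEdgeG₀ M a b → IsEdgeG₀ M v u
  samePair⇒IsEdgeG₀ {v = v} {u} {a} {b} e with samePair⇒ {v = v} {u} {a} {b} e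
  ... | inj₁ (refl , refl) = λ ab → ab
  ... | inj₂ (refl , refl) = IsEdgeG₀-sym {a} {b}

  edgeOfPart⇒IsEdgeG₀ : ∀ (p : Part n) → PartInG₀ M p → edgeOfPart v u p ≡ true → IsEdgeG₀ M v u
  edgeOfPart⇒IsEdgeG₀ {v = v} {u} (edge a b) ab e = samePair⇒IsEdgeG₀ {v = v} {u} {a} {b} e ab
  edgeOfPart⇒IsEdgeG₀ {v = v} {u} (triangle a b c) (ab , bc , ac) e
    with ∨-true (samePair v u a b) e
  ... | inj₁ e₁ = samePair⇒IsEdgeG₀ {v = v} {u} {a} {b} e₁ ab
  ... | inj₂ e₂ with ∨-true (samePair v u b c) e₂
  ...   | inj₁ e₂₁ = samePair⇒IsEdgeG₀ {v = v} {u} {b} {c} e₂₁ bc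
  ...   | inj₂ e₂₂ = samePair⇒IsEdgeG₀ {v = v} {u} {a} {c} e₂₂ ac

  PartInG₀⇒DistinctVertices : ∀ (p : Part n) → PartInG₀ M p → DistinctVertices p
  PartInG₀⇒DistinctVertices (triangle a b c) ((a≢b , _) , (b≢c , _) , (a≢c , _)) = a≢b , b≢c , a≢c
  PartInG₀⇒DistinctVertices (edge a b)       (a≢b , _)                             = a≢b

adjacent : List (Pair n) → Fin n → Fin n → Bool
adjacent M v u = not (v == u) ∧ not (inMatching M v u)

count-edgeOfPart-nonEdge : All (PartInG₀ M) D → ¬ IsEdgeG₀ M v u → count (edgeOfPart v u) D ≡ 0
count-edgeOfPart-nonEdge inG₀ nonEdge =
  count-none (All.map (λ {p} p∈G₀ → ¬-not (nonEdge ∘ edgeOfPart⇒IsEdgeG₀ p p∈G₀)) inG₀)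

count-edgeOfPart : IsDecomposition M D → ∀ v u → count (edgeOfPart v u) D ≡ [ adjacent M v u ]
count-edgeOfPart {M = M} (inG₀ , once) v u with v ≟ u | inMatching M v u in matched
... | yes refl | _     = count-edgeOfPart-nonEdge inG₀ (λ (v≢v , _) → v≢v refl)
... | no v≢u   | true  =
  count-edgeOfPart-nonEdge inG₀ (λ (_ , unmatched) → contradiction (trans (sym matched) unmatched) (λ ()))
... | no v≢u   | false = once v u (v≢u , matched)

module _ {M : List (Pair n)} {D : List (Part n)} (decomposition : IsDecomposition M D) where

  ∑-weights : (∀ v → partsAt D v ≡ 3) →
              ∑[ i < length D ] (2 * vertexCount (lookup D i) + orderedEdgeCount (lookup D i))
                ≡ 2 * (n * 3) + ∑[ v < n ] ∑[ u < n ] [ adjacent M v u ]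
  ∑-weights threeParts = begin
    ∑[ i < length D ] (2 * vertexCount (lookup D i) + orderedEdgeCount (lookup D i))
      ≡⟨ ∑-distrib-+ (λ i → 2 * vertexCount (lookup D i)) (λ i → orderedEdgeCount (lookup D i)) ⟩
    ∑[ i < length D ] (2 * vertexCount (lookup D i)) + ∑[ i < length D ] orderedEdgeCount (lookup D i)
      ≡⟨ cong (_+ ∑[ i < length D ] orderedEdgeCount (lookup D i))
              (*-distribˡ-sum 2 (λ i → vertexCount (lookup D i))) ⟨
    2 * ∑[ i < length D ] vertexCount (lookup D i) + ∑[ i < length D ] orderedEdgeCount (lookup D i)
      ≡⟨ cong₂ (λ x y → 2 * x + y) (∑-count vertexOfPart D) (∑∑-count edgeOfPart D) ⟨
    2 * ∑[ v < n ] partsAt D v + ∑[ v < n ] ∑[ u < n ] count (edgeOfPart v u) D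
      ≡⟨ cong₂ (λ x y → 2 * x + y)
               (trans (sum-cong-≗ threeParts) (∑-const n 3))
               (sum-cong-≗ (λ v → sum-cong-≗ (count-edgeOfPart decomposition v))) ⟩
    2 * (n * 3) + ∑[ v < n ] ∑[ u < n ] [ adjacent M v u ] ∎
    where open ≡-Reasoning

  3∣adjacentPairs : (∀ v → partsAt D v ≡ 3) → 3 ∣ ∑[ v < n ] ∑[ u < n ] [ adjacent M v u ]
  3∣adjacentPairs threeParts =
    ∣m+n∣m⇒∣n (subst (3 ∣_) (∑-weights threeParts) (∣-∑ 3∣weight)) (∣n⇒∣m*n 2 (n∣m*n n))
    where
    3∣weight : ∀ i → 3 ∣ 2 * vertexCount (lookup D i) + orderedEdgeCount (lookup D i)
    3∣weight i =
      3∣2*vertexCount+orderedEdgeCount (lookup D i)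
        (PartInG₀⇒DistinctVertices (lookup D i) (All.lookup (proj₁ decomposition) (∈-lookup i)))

pairEdge : Pair n → Part n
pairEdge (a , b) = edge a b

module _ {M : List (Pair n)} (matching : IsMatching M) where

  inMatching-irreflexive : ∀ v → inMatching M v v ≡ false
  inMatching-irreflexive v =
    cong (λ k → not (k ≡ᵇ 0)) (count-none (All.map loopFree (proj₁ matching)))
    where
    loopFree : ∀ {x} → proj₁ x ≢ proj₂ x → samePair v v (proj₁ x) (proj₂ x) ≡ false
    loopFree {a , b} a≢b = ¬-not (a≢b ∘ samePair-loop {v = v} {a = a} {b = b})

  count-pairEdges : ∀ v u → count (edgeOfPart v u ∘ pairEdge) M ≡ [ inMatching M v u ]
  count-pairEdges v u =
    m≤1⇒m≡[m≢0] (≤-trans (count-mono-≤ (λ { (a , b) → samePair⇒onPair {v = v} {u} {a} {b} }) M)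
                         (proj₂ matching v))

  [adjacent]+[inMatching] : ∀ v u → [ adjacent M v u ] + [ inMatching M v u ] ≡ [ not (v == u) ]
  [adjacent]+[inMatching] v u with v ≟ u
  ... | yes refl = cong [_] (inMatching-irreflexive v)
  ... | no _     = [not]+[] (inMatching M v u)

  ∑-pairEdges : ∀ (f : Part n → ℕ) {k} → (∀ {a b} → a ≢ b → f (edge a b) ≡ k) →
                ∑[ i < length M ] f (pairEdge (lookup M i)) ≡ length M * k
  ∑-pairEdges f {k} f≡k =
    trans (sum-cong-≗ (λ i → f≡k (All.lookup (proj₁ matching) (∈-lookup i))))
          (∑-const (length M) k)

  ∑∑-inMatching : ∑[ v < n ] ∑[ u < n ] [ inMatching M v u ] ≡ length M * 2
  ∑∑-inMatching = begin
    ∑[ v < n ] ∑[ u < n ] [ inMatching M v u ]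
      ≡⟨ sum-cong-≗ (λ v → sum-cong-≗ (count-pairEdges v)) ⟨
    ∑[ v < n ] ∑[ u < n ] count (edgeOfPart v u ∘ pairEdge) M
      ≡⟨ ∑∑-count (λ v u → edgeOfPart v u ∘ pairEdge) M ⟩
    ∑[ i < length M ] orderedEdgeCount (pairEdge (lookup M i))
      ≡⟨ ∑-pairEdges orderedEdgeCount orderedEdgeCount-edge ⟩
    length M * 2 ∎
    where open ≡-Reasoning

  adjacentPairs+matchedPairs :
    ∑[ v < n ] ∑[ u < n ] [ adjacent M v u ] + length M * 2 + n ≡ n * n
  adjacentPairs+matchedPairs = begin
    ∑[ v < n ] ∑[ u < n ] [ adjacent M v u ] + length M * 2 + n
      ≡⟨ cong (λ k → ∑[ v < n ] ∑[ u < n ] [ adjacent M v u ] + k + n) ∑∑-inMatching ⟨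
    ∑[ v < n ] ∑[ u < n ] [ adjacent M v u ] + ∑[ v < n ] ∑[ u < n ] [ inMatching M v u ] + n
      ≡⟨ cong (_+ n) (∑∑-distrib-+ (λ v u → [ adjacent M v u ]) (λ v u → [ inMatching M v u ])) ⟨
    ∑[ v < n ] ∑[ u < n ] ([ adjacent M v u ] + [ inMatching M v u ]) + n
      ≡⟨ cong (_+ n) (sum-cong-≗ (λ v → sum-cong-≗ ([adjacent]+[inMatching] v))) ⟩
    ∑[ v < n ] ∑[ u < n ] [ not (v == u) ] + n
      ≡⟨ ∑∑-[≢] {n} ⟩
    n * n ∎
    where open ≡-Reasoning

  matching-bound : length M * 2 ≤ n
  matching-bound = begin
    length M * 2                                ≡⟨ ∑-pairEdges vertexCount vertexCount-edge ⟨
    ∑[ i < length M ] vertexCount (pairEdge (lookup M i))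
                                                ≡⟨ ∑-count (λ v → vertexOfPart v ∘ pairEdge) M ⟨
    ∑[ v < n ] count (onPair v) M               ≤⟨ ∑-mono-≤ (proj₂ matching) ⟩
    ∑[ v < n ] 1                                ≡⟨ ∑-const n 1 ⟩
    n * 1                                       ≡⟨ *-identityʳ n ⟩
    n                                           ∎
    where open ≤-Reasoning

x+n≡n*n⇒3∣x : ∀ {n x} → n ≡ 6 ⊎ n ≡ 7 → x + n ≡ n * n → 3 ∣ x
x+n≡n*n⇒3∣x {x = x} (inj₁ refl) eq = subst (3 ∣_) (sym (+-cancelʳ-≡ 6 x 30 eq)) (divides 10 refl)
x+n≡n*n⇒3∣x {x = x} (inj₂ refl) eq = subst (3 ∣_) (sym (+-cancelʳ-≡ 7 x 42 eq)) (divides 14 refl)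

n≡6⊎n≡7⇒n≤7 : ∀ {n} → n ≡ 6 ⊎ n ≡ 7 → n ≤ 7
n≡6⊎n≡7⇒n≤7 (inj₁ refl) = n≤1+n 6
n≡6⊎n≡7⇒n≤7 (inj₂ refl) = ≤-refl

3∣m*2⇒m≡3 : ∀ {m} → 3 ∣ m * 2 → m ≥ 1 → m * 2 ≤ 7 → m ≡ 3
3∣m*2⇒m≡3 {1} 3∣2 _ _ with () ← n∣m⇒m%n≡0 2 3 3∣2
3∣m*2⇒m≡3 {2} 3∣4 _ _ with () ← n∣m⇒m%n≡0 4 3 3∣4
3∣m*2⇒m≡3 {3} _   _ _ = refl
3∣m*2⇒m≡3 {suc (suc (suc (suc _)))} _ _ (s≤s (s≤s (s≤s (s≤s (s≤s (s≤s (s≤s ())))))))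

proposition4p5 : (n m : ℕ) → (n ≡ 6 ⊎ n ≡ 7) → m ≥ 1 →
    (M : List (Pair n)) → IsMatching M → length M ≡ m →
    (D : List (Part n)) → IsDecomposition M D →
    ((v : Fin n) → partsAt D v ≡ 3) →
    m ≡ 3
proposition4p5 n .(length M) n≡6⊎n≡7 m≥1 M matching refl D decomposition threeParts =
  3∣m*2⇒m≡3 3∣m*2 m≥1 (≤-trans (matching-bound matching) (n≡6⊎n≡7⇒n≤7 n≡6⊎n≡7))
  where
  3∣m*2 : 3 ∣ length M * 2
  3∣m*2 = ∣m+n∣m⇒∣n (x+n≡n*n⇒3∣x n≡6⊎n≡7 (adjacentPairs+matchedPairs matching))
                    (3∣adjacentPairs decomposition threeParts)
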